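{- Let $E=\mathbf F_3\times\mathbf F_3$ and, for $i\in\mathbf F_3$, let $A_i=\{(x,y):y=i\}$, $B_i=\{(x,y):x=i\}$, $C_i=\{(x,y):x-y=i\}$, $D_i=\{(x,y):x+y=i\}$. Call a sparse paving matroid $M$ of rank $5$ on $E$ a TTT matroid if every set $A_i\cup B_j$ with $(i,j)\neq(0,0)$ is a circuit-hyperplane of $M$ and moreover either (first kind) every circuit-hyperplane of $M$ is of the form $A_i\cup B_j$ or $C_i\cup D_j$ and $A_0\cup B_0$ is not a circuit-hyperplane of $M$, or (second kind) $\big((A_0\cup B_0)\setminus\{(0,0)\}\big)\cup\{(1,1)\}$ is a circuit-hyperplane of $M$. Then no TTT matroid satisfies the common information property, and the dual of no TTT matroid satisfies the Ahlswede–Körner property.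
   Context: A polymatroid is $(E,f)$ with $E$ finite, $f$ monotone, submodular, $f(\emptyset)=0$; a matroid is a polymatroid with integer-valued $f$ and $f(x)\le1$. A sparse paving matroid of rank $k$ is determined by its circuit-hyperplanes ($k$-sets pairwise meeting in at most $k-2$ elements; a $k$-set is a basis iff it is not a circuit-hyperplane). The dual of $(E,f)$ is $(E,f^*)$, $f^*(X)=|X|-f(E)+f(E\setminus X)$. Notation: $f(X\mid Z)=f(X\cup Z)-f(Z)$, $f(X:Y\mid Z)=f(X\cup Z)+f(Y\cup Z)-f(X\cup Y\cup Z)-f(Z)$. An extension of $(E,f)$ is a polymatroid $(E\cup Z,g)$, $E\cap Z=\emptyset$, $g|_{\mathcal P(E)}=f$. For $X,Y\subseteq E$: a CI extension for $(X,Y)$ satisfies $g(Z\mid X)=g(Z\mid Y)=0$ and $g(X:Y\mid Z)=0$; an AK extension for $(X,Y)$ satisfies $g(Z\mid X)=0$ and $g(X'\mid Z)=g(X'\mid Y)$ for all $X'\subseteq X$. For P one of CI, AK: every polymatroid is $0$-P; for $k\ge1$ it is $k$-P if for every pair of subsets of the ground set it admits a P extension that is $(k-1)$-P; it satisfies the P property (common information, resp. Ahlswede–Körner property) if it is $k$-P for all $k\ge1$. -}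

module Defs where

open import Level using (Level; suc; zero)
open import Data.Nat as ℕ using (ℕ; _≡ᵇ_; _%_)
open import Data.Bool using (Bool; true; false; if_then_else_)
open import Data.Fin using (Fin; toℕ; remQuot; combine)
open import Data.Fin.Subset as S using (Subset; _∪_; _∩_; ∁; ∣_∣; _⊆_; ⁅_⁆; _-_)
open import Data.Vec using (Vec; _++_; replicate; tabulate)
open import Data.Product using (Σ; ∃; ∃₂; _×_; _,_; proj₁; proj₂)
open import Data.Sum using (_⊎_)
open import Data.Unit using (⊤)
open import Relation.Binary.PropositionalEquality using (_≡_; _≢_)
open import Relation.Nullary using (¬_)
open import Algebra.Structures using (IsCommutativeRing)
open import Relation.Binary.Structures using (IsTotalOrder)

record RealNumbers : Set₁ where
  infixl 6 _+_ _-ᵣ_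
  infixl 7 _*_
  infix 4 _≤_
  field
    ℝ      : Set
    _+_    : ℝ → ℝ → ℝ
    _*_    : ℝ → ℝ → ℝ
    -_     : ℝ → ℝ
    0ℝ     : ℝ
    1ℝ     : ℝ
    _≤_    : ℝ → ℝ → Set
    isCommutativeRing : IsCommutativeRing _≡_ _+_ _*_ -_ 0ℝ 1ℝ
    0≢1    : 0ℝ ≢ 1ℝ
    inverse : ∀ x → x ≢ 0ℝ → Σ ℝ λ y → x * y ≡ 1ℝ
    isTotalOrder : IsTotalOrder _≡_ _≤_
    +-mono : ∀ {x y} z → x ≤ y → x + z ≤ y + z
    *-nonneg : ∀ {x y} → 0ℝ ≤ x → 0ℝ ≤ y → 0ℝ ≤ x * y
    complete : (P : ℝ → Set) → Σ ℝ P → Σ ℝ (λ b → ∀ x → P x → x ≤ b) →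
               Σ ℝ λ s → (∀ x → P x → x ≤ s) × (∀ b → (∀ x → P x → x ≤ b) → s ≤ b)

  _-ᵣ_ : ℝ → ℝ → ℝ
  x -ᵣ y = x + (- y)

  fromℕ : ℕ → ℝ
  fromℕ ℕ.zero    = 0ℝ
  fromℕ (ℕ.suc n) = 1ℝ + fromℕ n

module Poly (R : RealNumbers) where
  open RealNumbers R

  SetFn : ℕ → Set
  SetFn n = Subset n → ℝ

  record IsPolymatroid {n : ℕ} (f : SetFn n) : Set where
    field
      empty      : f S.⊥ ≡ 0ℝ
      monotone   : ∀ X Y → X ⊆ Y → f X ≤ f Y
      submodular : ∀ X Y → f (X ∪ Y) + f (X ∩ Y) ≤ f X + f Y

  cond : ∀ {n} → SetFn n → Subset n → Subset n → ℝ
  cond f X Z = f (X ∪ Z) -ᵣ f Z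

  mutualInfo : ∀ {n} → SetFn n → Subset n → Subset n → Subset n → ℝ
  mutualInfo f X Y Z = ((f (X ∪ Z) + f (Y ∪ Z)) -ᵣ f (X ∪ Y ∪ Z)) -ᵣ f Z

  dual : ∀ {n} → SetFn n → SetFn n
  dual f X = (fromℕ ∣ X ∣ -ᵣ f S.⊤) + f (∁ X)

  -- Extensions: ground set E ∪ Z with E = first n points of Fin (n + m),
  -- Z = last m points.  A subset X of E is X ++ ∅.
  liftE : ∀ {n} m → Subset n → Subset (n ℕ.+ m)
  liftE m X = X ++ S.⊥

  Zset : ∀ n m → Subset (n ℕ.+ m)
  Zset n m = replicate n false ++ S.⊤

  IsExtension : ∀ {n m} → SetFn n → SetFn (n ℕ.+ m) → Set
  IsExtension {n} {m} f g = IsPolymatroid g × (∀ X → g (liftE m X) ≡ f X)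

  IsCIExt : ∀ {n m} → SetFn (n ℕ.+ m) → Subset n → Subset n → Set
  IsCIExt {n} {m} g X Y =
    (cond g (Zset n m) (liftE m X) ≡ 0ℝ) ×
    (cond g (Zset n m) (liftE m Y) ≡ 0ℝ) ×
    (mutualInfo g (liftE m X) (liftE m Y) (Zset n m) ≡ 0ℝ)

  IsAKExt : ∀ {n m} → SetFn (n ℕ.+ m) → Subset n → Subset n → Set
  IsAKExt {n} {m} g X Y =
    (cond g (Zset n m) (liftE m X) ≡ 0ℝ) ×
    (∀ X′ → X′ ⊆ X → cond g (liftE m X′) (Zset n m) ≡ cond g (liftE m X′) (liftE m Y))

  ExtKind : Set₁
  ExtKind = ∀ {n m} → SetFn (n ℕ.+ m) → Subset n → Subset n → Set

  k-P : ExtKind → ℕ → ∀ {n} → SetFn n → Set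
  k-P P ℕ.zero    f = ⊤
  k-P P (ℕ.suc k) {n} f =
    ∀ X Y → Σ ℕ λ m → Σ (SetFn (n ℕ.+ m)) λ g →
      IsExtension f g × P {n} {m} g X Y × k-P P k g

  CIProperty : ∀ {n} → SetFn n → Set
  CIProperty f = ∀ k → k-P IsCIExt k f

  AKProperty : ∀ {n} → SetFn n → Set
  AKProperty f = ∀ k → k-P IsAKExt k f

-- Sparse paving matroids of rank k on Fin n, given by their
-- circuit-hyperplanes: k-sets pairwise meeting in at most k-2 elements.

record SparsePaving (k n : ℕ) : Set where
  field
    isCH : Subset n → Bool
    CH-size : ∀ X → isCH X ≡ true → ∣ X ∣ ≡ k
    CH-meet : ∀ X Y → isCH X ≡ true → isCH Y ≡ true → X ≢ Y →
              ∣ X ∩ Y ∣ ℕ.≤ k ℕ.∸ 2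

-- rank function: a k-set is a basis iff it is not a circuit-hyperplane
rank : ∀ {k n} → SparsePaving k n → Subset n → ℕ
rank {k} M X = if SparsePaving.isCH M X then k ℕ.∸ 1 else ℕ._⊓_ ∣ X ∣ k

rankℝ : (R : RealNumbers) → ∀ {k n} → SparsePaving k n → Subset n → RealNumbers.ℝ R
rankℝ R M X = RealNumbers.fromℕ R (rank M X)

-- E = F₃ × F₃, encoded as Fin 9 = Fin (3 * 3) via remQuot/combine:
-- the point (x , y) is  combine x y.

F3 : Set
F3 = Fin 3

Pt : Set
Pt = Fin 9

xc : Pt → F3
xc p = proj₁ (remQuot {3} 3 p)

yc : Pt → F3
yc p = proj₂ (remQuot {3} 3 p)

pt : F3 → F3 → Pt
pt x y = combine x y

_+₃_ : F3 → F3 → ℕ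
x +₃ y = (toℕ x ℕ.+ toℕ y) % 3

_-₃_ : F3 → F3 → ℕ
x -₃ y = (toℕ x ℕ.+ 2 ℕ.* toℕ y) % 3

A B C D : F3 → Subset 9
A i = tabulate λ p → toℕ (yc p) ≡ᵇ toℕ i
B i = tabulate λ p → toℕ (xc p) ≡ᵇ toℕ i
C i = tabulate λ p → (xc p -₃ yc p) ≡ᵇ toℕ i
D i = tabulate λ p → (xc p +₃ yc p) ≡ᵇ toℕ i

0₃ 1₃ : F3
0₃ = Fin.zero
1₃ = Fin.suc Fin.zero

FirstKind : SparsePaving 5 9 → Set
FirstKind M =
  (∀ X → SparsePaving.isCH M X ≡ true →
     ∃₂ λ i j → (X ≡ A i ∪ B j) ⊎ (X ≡ C i ∪ D j)) ×
  (SparsePaving.isCH M (A 0₃ ∪ B 0₃) ≡ false)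

SecondKind : SparsePaving 5 9 → Set
SecondKind M =
  SparsePaving.isCH M (((A 0₃ ∪ B 0₃) - pt 0₃ 0₃) ∪ ⁅ pt 1₃ 1₃ ⁆) ≡ true

IsTTT : SparsePaving 5 9 → Set
IsTTT M =
  (∀ i j → ¬ (i ≡ 0₃ × j ≡ 0₃) → SparsePaving.isCH M (A i ∪ B j) ≡ true) ×
  (FirstKind M ⊎ SecondKind M)

module Submission where

-- A CI or AK extension may be assumed to add a single point: blowing a point up into the
-- new block Z is a lattice map of subsets, and pulling back along it preserves polymatroids,
-- extensions and the CI/AK conditions.  What remains is a Shannon-type certificate in the
-- collapsed polymatroid, each step an instance of submodularity whose other three terms are
-- already bounded by integers.
--
-- CI: a common information Z of A₁ and A₂ lies in the closure of both, hence of every B_j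
-- (as A₁ ∪ B_j and A₂ ∪ B_j are circuit-hyperplanes), then of A₀ and of the point
-- (0,0) = A₀ ∩ B₀.  So h(Z) ≥ 1 but h(Z ∪ (0,0)) ≤ 1, against the independence of
-- A₁ ∪ {(0,0)}.
--
-- AK: in the dual, take nested AK extensions for the pairs (X₁, Y₁), (X₂, Y₂) and
-- (X₃, Z₁ ∪ Z₂) below.  Then Z₃ lies in the closure of each row B_j ∖ A₀ while h(Z₃) ≥ 1,
-- so two rows together have value at most 3, whereas (B₁ ∪ B₂) ∖ A₀ has dual rank 4
-- because A₀ ∪ B₀ is not a circuit-hyperplane.

open import Defs
open import Algebra.Bundles using (CommutativeRing)
open import Data.Bool using (Bool; true; false; _∨_; _∧_; T)
open import Data.Empty using (⊥)
open import Data.Fin.Subset as S using (Subset; _∪_; _∩_; _⊆_; _─_; ∁; ∣_∣; ⁅_⁆; inside; outside)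
open import Data.Fin.Subset.Properties using (p⊆p∪q; drop-∷-⊆; ∪-comm; _⊆?_)
open import Data.Nat as ℕ using (ℕ; zero; suc)
open import Data.Nat.Properties using (≤ᵇ⇒≤; m+[n∸m]≡n)
open import Data.Product using (Σ; _×_; _,_; proj₁; proj₂)
open import Data.Sum using (_⊎_; inj₁; inj₂)
import Data.Fin as Fin
open import Data.Unit using (tt)
open import Data.Vec using (Vec; []; _∷_; _++_; replicate; take; drop; zipWith; here)
open import Data.Vec.Properties using (zipWith-++; zipWith-replicate; take-zipWith; drop-zipWith)
open import Function using (_∘_; id)
open import Relation.Binary.Bundles using (Poset)
open import Relation.Binary.PropositionalEquality
  using (_≡_; _≢_; refl; sym; trans; cong; cong₂; subst; subst₂; module ≡-Reasoning)
open import Relation.Binary.Structures using (IsTotalOrder)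
open import Relation.Nullary using (¬_; contradiction)
open import Relation.Nullary.Decidable using (True; False; toWitness; toWitnessFalse)

-- Integer bounds in an ordered field

module RealBounds (R : RealNumbers) where
  open RealNumbers R
  open IsTotalOrder isTotalOrder using (antisym)
  open IsTotalOrder isTotalOrder public using () renaming (trans to ≤-trans; reflexive to ≤-reflexive)

  commutativeRing : CommutativeRing _ _
  commutativeRing = record { isCommutativeRing = isCommutativeRing }

  open CommutativeRing commutativeRing public using (+-comm)
  open CommutativeRing commutativeRing
    using (+-assoc; +-identityˡ; -‿inverseʳ; +-abelianGroup; +-commutativeMonoid; ring)
  open import Algebra.Properties.AbelianGroup +-abelianGroup
    using (∙-cancelʳ; //-rightDividesˡ; //-rightDividesʳ; xyx⁻¹≈y; ⁻¹-involutive)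
  open import Algebra.Properties.Ring ring using (-1*x≈-x)
  open import Algebra.Solver.CommutativeMonoid +-commutativeMonoid using (solve; _⊜_; _⊕_)

  poset : Poset _ _ _
  poset = record { isPartialOrder = IsTotalOrder.isPartialOrder isTotalOrder }

  open import Relation.Binary.Reasoning.PartialOrder poset

  -- Opaque, so that a bound ⟨ a ⟩ determines a by unification.
  opaque
    ⟨_⟩ : ℕ → ℝ
    ⟨_⟩ = fromℕ

    fromℕ≡⟨⟩ : ∀ a → fromℕ a ≡ ⟨ a ⟩
    fromℕ≡⟨⟩ a = refl

    ⟨⟩-suc : ∀ a → ⟨ suc a ⟩ ≡ 1ℝ + ⟨ a ⟩
    ⟨⟩-suc a = refl

    ⟨⟩-+ : ∀ a b → ⟨ a ℕ.+ b ⟩ ≡ ⟨ a ⟩ + ⟨ b ⟩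
    ⟨⟩-+ zero    b = sym (+-identityˡ ⟨ b ⟩)
    ⟨⟩-+ (suc a) b = trans (cong (1ℝ +_) (⟨⟩-+ a b)) (sym (+-assoc 1ℝ ⟨ a ⟩ ⟨ b ⟩))

  ≥-reflexive : ∀ {x y} → x ≡ y → y ≤ x
  ≥-reflexive x≡y = ≤-reflexive (sym x≡y)

  ⟨⟩-+-≡ : ∀ a b c d → a ℕ.+ b ≡ c ℕ.+ d → ⟨ a ⟩ + ⟨ b ⟩ ≡ ⟨ c ⟩ + ⟨ d ⟩
  ⟨⟩-+-≡ a b c d a+b≡c+d =
    trans (sym (⟨⟩-+ a b)) (trans (cong ⟨_⟩ a+b≡c+d) (⟨⟩-+ c d))

  x-y≡z⇒x≡z+y : ∀ {x y z} → x -ᵣ y ≡ z → x ≡ z + y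
  x-y≡z⇒x≡z+y {x} {y} x-y≡z = trans (sym (//-rightDividesˡ y x)) (cong (_+ y) x-y≡z)

  x-y≡0⇒x≡y : ∀ {x y} → x -ᵣ y ≡ 0ℝ → x ≡ y
  x-y≡0⇒x≡y {y = y} x-y≡0 = trans (x-y≡z⇒x≡z+y x-y≡0) (+-identityˡ y)

  x-y≡z-w⇒x+w≡z+y : ∀ {x y z w} → x -ᵣ y ≡ z -ᵣ w → x + w ≡ z + y
  x-y≡z-w⇒x+w≡z+y {x} {y} {z} {w} x-y≡z-w = begin-equality
    x + w
      ≡⟨ cong (_+ w) (x-y≡z⇒x≡z+y x-y≡z-w) ⟩
    ((z + - w) + y) + w
      ≡⟨ solve 4 (λ z -w y w → ((z ⊕ -w) ⊕ y) ⊕ w ⊜ ((z ⊕ y) ⊕ -w) ⊕ w) refl z (- w) y w ⟩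
    ((z + y) + - w) + w
      ≡⟨ //-rightDividesˡ w (z + y) ⟩
    z + y ∎

  x+y-z-w≡0⇒x+y≡z+w : ∀ {x y z w} → ((x + y) -ᵣ z) -ᵣ w ≡ 0ℝ → x + y ≡ z + w
  x+y-z-w≡0⇒x+y≡z+w {z = z} {w} x+y-z-w≡0 =
    trans (x-y≡z⇒x≡z+y (x-y≡0⇒x≡y x+y-z-w≡0)) (+-comm w z)

  x+z≡y+v⇒x-y+z≡v : ∀ {x y z v} → x + z ≡ y + v → (x -ᵣ y) + z ≡ v
  x+z≡y+v⇒x-y+z≡v {x} {y} {z} {v} x+z≡y+v = begin-equality
    (x + - y) + z   ≡⟨ solve 3 (λ x -y z → (x ⊕ -y) ⊕ z ⊜ (x ⊕ z) ⊕ -y) refl x (- y) z ⟩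
    (x + z) + - y   ≡⟨ cong (_-ᵣ y) x+z≡y+v ⟩
    (y + v) + - y   ≡⟨ xyx⁻¹≈y y v ⟩
    v               ∎

  +-exchange : ∀ {a b c d y z} → a + y ≡ b + z → c + y ≡ d + z → a + d ≡ b + c
  +-exchange {a} {b} {c} {d} {y} {z} a+y≡b+z c+y≡d+z =
    ∙-cancelʳ (y + z) (a + d) (b + c) (begin-equality
      (a + d) + (y + z)
        ≡⟨ solve 4 (λ a d y z → (a ⊕ d) ⊕ (y ⊕ z) ⊜ (a ⊕ y) ⊕ (d ⊕ z)) refl a d y z ⟩
      (a + y) + (d + z)
        ≡⟨ cong₂ _+_ a+y≡b+z (sym c+y≡d+z) ⟩
      (b + z) + (c + y)
        ≡⟨ solve 4 (λ b z c y → (b ⊕ z) ⊕ (c ⊕ y) ⊜ (b ⊕ c) ⊕ (y ⊕ z)) refl b z c y ⟩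
      (b + c) + (y + z) ∎)

  +-monoˡ-≤ : ∀ {x y} z → x ≤ y → z + x ≤ z + y
  +-monoˡ-≤ {x} {y} z x≤y = begin
    z + x  ≡⟨ +-comm z x ⟩
    x + z  ≤⟨ +-mono z x≤y ⟩
    y + z  ≡⟨ +-comm y z ⟩
    z + y  ∎

  +-mono-≤ : ∀ {x y u v} → x ≤ y → u ≤ v → x + u ≤ y + v
  +-mono-≤ {y = y} {u} x≤y u≤v = ≤-trans (+-mono u x≤y) (+-monoˡ-≤ y u≤v)

  +-cancelʳ-≤ : ∀ {x y} z → x + z ≤ y + z → x ≤ y
  +-cancelʳ-≤ {x} {y} z x+z≤y+z = begin
    x              ≡⟨ sym (//-rightDividesʳ z x) ⟩
    (x + z) -ᵣ z   ≤⟨ +-mono (- z) x+z≤y+z ⟩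
    (y + z) -ᵣ z   ≡⟨ //-rightDividesʳ z y ⟩
    y              ∎

  1≰0 : ¬ (1ℝ ≤ 0ℝ)
  1≰0 1≤0 = 0≢1 (antisym 0≤1 1≤0)
    where
    0≤-1 : 0ℝ ≤ - 1ℝ
    0≤-1 = begin
      0ℝ          ≡⟨ sym (-‿inverseʳ 1ℝ) ⟩
      1ℝ + - 1ℝ   ≤⟨ +-mono (- 1ℝ) 1≤0 ⟩
      0ℝ + - 1ℝ   ≡⟨ +-identityˡ (- 1ℝ) ⟩
      - 1ℝ        ∎
    0≤1 : 0ℝ ≤ 1ℝ
    0≤1 = begin
      0ℝ            ≤⟨ *-nonneg 0≤-1 0≤-1 ⟩
      - 1ℝ * - 1ℝ   ≡⟨ -1*x≈-x (- 1ℝ) ⟩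
      - (- 1ℝ)      ≡⟨ ⁻¹-involutive 1ℝ ⟩
      1ℝ            ∎

  infeasible : ∀ {x} n → ⟨ suc n ⟩ ≤ x → x ≤ ⟨ n ⟩ → ⊥
  infeasible n 1+n≤x x≤n = 1≰0 (+-cancelʳ-≤ ⟨ n ⟩ (begin
    1ℝ + ⟨ n ⟩  ≡⟨ sym (⟨⟩-suc n) ⟩
    ⟨ suc n ⟩   ≤⟨ ≤-trans 1+n≤x x≤n ⟩
    ⟨ n ⟩       ≡⟨ sym (+-identityˡ ⟨ n ⟩) ⟩
    0ℝ + ⟨ n ⟩  ∎))

  upper-bound : ∀ {x y u v} a {b c d} → x + y ≤ u + v →
                ⟨ b ⟩ ≤ y → u ≤ ⟨ c ⟩ → v ≤ ⟨ d ⟩ → c ℕ.+ d ≡ a ℕ.+ b → x ≤ ⟨ a ⟩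
  upper-bound {x} {y} {u} {v} a {b} {c} {d} x+y≤u+v b≤y u≤c v≤d c+d≡a+b =
    +-cancelʳ-≤ ⟨ b ⟩ (begin
      x + ⟨ b ⟩       ≤⟨ +-monoˡ-≤ x b≤y ⟩
      x + y           ≤⟨ x+y≤u+v ⟩
      u + v           ≤⟨ +-mono-≤ u≤c v≤d ⟩
      ⟨ c ⟩ + ⟨ d ⟩   ≡⟨ ⟨⟩-+-≡ c d a b c+d≡a+b ⟩
      ⟨ a ⟩ + ⟨ b ⟩   ∎)

  lower-bound : ∀ {x y u v a b} c {d} → x + y ≤ u + v →
                ⟨ a ⟩ ≤ x → ⟨ b ⟩ ≤ y → v ≤ ⟨ d ⟩ → a ℕ.+ b ≡ c ℕ.+ d → ⟨ c ⟩ ≤ u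
  lower-bound {x} {y} {u} {v} {a} {b} c {d} x+y≤u+v a≤x b≤y v≤d a+b≡c+d =
    +-cancelʳ-≤ ⟨ d ⟩ (begin
      ⟨ c ⟩ + ⟨ d ⟩   ≡⟨ ⟨⟩-+-≡ c d a b (sym a+b≡c+d) ⟩
      ⟨ a ⟩ + ⟨ b ⟩   ≤⟨ +-mono-≤ a≤x b≤y ⟩
      x + y           ≤⟨ x+y≤u+v ⟩
      u + v           ≤⟨ +-monoˡ-≤ u v≤d ⟩
      u + ⟨ d ⟩       ∎)

  difference-bound : ∀ {x y u v a c} → x + y ≤ u + v →
                     ⟨ a ⟩ ≤ x → u ≤ ⟨ c ⟩ → y + ⟨ a ⟩ ≤ v + ⟨ c ⟩
  difference-bound {x} {y} {u} {v} {a} {c} x+y≤u+v a≤x u≤c = begin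
    y + ⟨ a ⟩   ≡⟨ +-comm y ⟨ a ⟩ ⟩
    ⟨ a ⟩ + y   ≤⟨ +-mono y a≤x ⟩
    x + y       ≤⟨ x+y≤u+v ⟩
    u + v       ≤⟨ +-mono v u≤c ⟩
    ⟨ c ⟩ + v   ≡⟨ +-comm ⟨ c ⟩ v ⟩
    v + ⟨ c ⟩   ∎

  difference-elim : ∀ {x y u w a c d} b → x + w ≤ y + u → u ≤ ⟨ a ⟩ →
                    y + ⟨ c ⟩ ≤ w + ⟨ d ⟩ → a ℕ.+ d ≡ b ℕ.+ c → x ≤ ⟨ b ⟩
  difference-elim {x} {y} {u} {w} {a} {c} {d} b x+w≤y+u u≤a y+c≤w+d a+d≡b+c =
    +-cancelʳ-≤ ⟨ c ⟩ (+-cancelʳ-≤ (w + y) (begin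
      (x + ⟨ c ⟩) + (w + y)
        ≡⟨ solve 4 (λ x c w y → (x ⊕ c) ⊕ (w ⊕ y) ⊜ (x ⊕ w) ⊕ (y ⊕ c)) refl x ⟨ c ⟩ w y ⟩
      (x + w) + (y + ⟨ c ⟩)
        ≤⟨ +-mono-≤ (≤-trans x+w≤y+u (+-monoˡ-≤ y u≤a)) y+c≤w+d ⟩
      (y + ⟨ a ⟩) + (w + ⟨ d ⟩)
        ≡⟨ solve 4 (λ y a w d → (y ⊕ a) ⊕ (w ⊕ d) ⊜ (a ⊕ d) ⊕ (w ⊕ y)) refl y ⟨ a ⟩ w ⟨ d ⟩ ⟩
      (⟨ a ⟩ + ⟨ d ⟩) + (w + y)
        ≡⟨ cong (_+ (w + y)) (⟨⟩-+-≡ a d b c a+d≡b+c) ⟩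
      (⟨ b ⟩ + ⟨ c ⟩) + (w + y) ∎))

-- Lattice maps of subsets

p⊆q⇒p∪q≡q : ∀ {n} {p q : Subset n} → p ⊆ q → p ∪ q ≡ q
p⊆q⇒p∪q≡q {p = []}          {[]}          _   = refl
p⊆q⇒p∪q≡q {p = outside ∷ p} {b ∷ q}       p⊆q = cong (b ∷_) (p⊆q⇒p∪q≡q (drop-∷-⊆ p⊆q))
p⊆q⇒p∪q≡q {p = inside ∷ p}  {inside ∷ q}  p⊆q = cong (true ∷_) (p⊆q⇒p∪q≡q (drop-∷-⊆ p⊆q))
p⊆q⇒p∪q≡q {p = inside ∷ p}  {outside ∷ q} p⊆q = contradiction (p⊆q here) λ ()

record IsLatticeMap {n′ n} (φ : Subset n′ → Subset n) : Set where
  field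
    ⊥-preserving : φ S.⊥ ≡ S.⊥
    ∪-preserving : ∀ X Y → φ (X ∪ Y) ≡ φ X ∪ φ Y
    ∩-preserving : ∀ X Y → φ (X ∩ Y) ≡ φ X ∩ φ Y

  ⊆-preserving : ∀ {X Y} → X ⊆ Y → φ X ⊆ φ Y
  ⊆-preserving {X} {Y} X⊆Y =
    subst (φ X ⊆_) (trans (sym (∪-preserving X Y)) (cong φ (p⊆q⇒p∪q≡q X⊆Y))) (p⊆p∪q (φ Y))

open IsLatticeMap

id-isLatticeMap : ∀ {n} → IsLatticeMap {n} id
id-isLatticeMap = record
  { ⊥-preserving = refl
  ; ∪-preserving = λ _ _ → refl
  ; ∩-preserving = λ _ _ → refl
  }

diagonal : ∀ m → Subset 1 → Subset m
diagonal m (b ∷ []) = replicate m b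

diagonal-isLatticeMap : ∀ m → IsLatticeMap (diagonal m)
diagonal-isLatticeMap m = record
  { ⊥-preserving = refl
  ; ∪-preserving = λ { (b ∷ []) (c ∷ []) → sym (zipWith-replicate _∨_ b c) }
  ; ∩-preserving = λ { (b ∷ []) (c ∷ []) → sym (zipWith-replicate _∧_ b c) }
  }

take-++ : ∀ {A : Set} {n m} (xs : Vec A n) (ys : Vec A m) → take n (xs ++ ys) ≡ xs
take-++ []       ys = refl
take-++ (x ∷ xs) ys = cong (x ∷_) (take-++ xs ys)

drop-++ : ∀ {A : Set} {n m} (xs : Vec A n) (ys : Vec A m) → drop n (xs ++ ys) ≡ ys
drop-++ []       ys = refl
drop-++ (x ∷ xs) ys = drop-++ xs ys

replicate-+ : ∀ {A : Set} n {m} (x : A) → replicate (n ℕ.+ m) x ≡ replicate n x ++ replicate m x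
replicate-+ zero    x = refl
replicate-+ (suc n) x = cong (x ∷_) (replicate-+ n x)

infixr 5 _⊕_

_⊕_ : ∀ {n′ n m′ m} → (Subset n′ → Subset n) → (Subset m′ → Subset m) →
      Subset (n′ ℕ.+ m′) → Subset (n ℕ.+ m)
_⊕_ {n′} φ χ S = φ (take n′ S) ++ χ (drop n′ S)

⊕-isLatticeMap : ∀ {n′ n m′ m} {φ : Subset n′ → Subset n} {χ : Subset m′ → Subset m} →
                 IsLatticeMap φ → IsLatticeMap χ → IsLatticeMap (φ ⊕ χ)
⊕-isLatticeMap {n′} {n} {m′} {m} {φ = φ} {χ} φ-map χ-map = record
  { ⊥-preserving = begin
      (φ ⊕ χ) S.⊥
        ≡⟨ cong (λ U → φ (take n′ U) ++ χ (drop n′ U)) (replicate-+ n′ {m′} false) ⟩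
      φ (take n′ (S.⊥ {n′} ++ S.⊥ {m′})) ++ χ (drop n′ (S.⊥ {n′} ++ S.⊥ {m′}))
        ≡⟨ cong₂ (λ U V → φ U ++ χ V)
                 (take-++ (S.⊥ {n′}) (S.⊥ {m′})) (drop-++ (S.⊥ {n′}) (S.⊥ {m′})) ⟩
      φ S.⊥ ++ χ S.⊥
        ≡⟨ cong₂ _++_ (⊥-preserving φ-map) (⊥-preserving χ-map) ⟩
      S.⊥ {n} ++ S.⊥ {m}
        ≡⟨ sym (replicate-+ n {m} false) ⟩
      S.⊥ ∎
  ; ∪-preserving = preserves _∨_ (∪-preserving φ-map) (∪-preserving χ-map)
  ; ∩-preserving = preserves _∧_ (∩-preserving φ-map) (∩-preserving χ-map)
  }
  where
  open ≡-Reasoning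
  preserves : ∀ (_•_ : Bool → Bool → Bool) → (∀ X Y → φ (zipWith _•_ X Y) ≡ zipWith _•_ (φ X) (φ Y)) →
              (∀ X Y → χ (zipWith _•_ X Y) ≡ zipWith _•_ (χ X) (χ Y)) →
              ∀ S T → (φ ⊕ χ) (zipWith _•_ S T) ≡ zipWith _•_ ((φ ⊕ χ) S) ((φ ⊕ χ) T)
  preserves _•_ φ-• χ-• S T = begin
    φ (take n′ (S ⊙ T)) ++ χ (drop n′ (S ⊙ T))
      ≡⟨ cong₂ (λ U V → φ U ++ χ V) (take-zipWith _•_ S T) (drop-zipWith _•_ S T) ⟩
    φ (take n′ S ⊙ take n′ T) ++ χ (drop n′ S ⊙ drop n′ T)
      ≡⟨ cong₂ _++_ (φ-• _ _) (χ-• _ _) ⟩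
    (φ (take n′ S) ⊙ φ (take n′ T)) ++ (χ (drop n′ S) ⊙ χ (drop n′ T))
      ≡⟨ sym (zipWith-++ _•_ (φ (take n′ S)) (χ (drop n′ S)) (φ (take n′ T)) (χ (drop n′ T))) ⟩
    (φ ⊕ χ) S ⊙ (φ ⊕ χ) T ∎
    where
    _⊙_ : ∀ {k} → Subset k → Subset k → Subset k
    _⊙_ = zipWith _•_

module Polymatroids (R : RealNumbers) where
  open RealNumbers R
  open Poly R
  open RealBounds R

  module PolymatroidBounds {n} {g : SetFn n} (poly : IsPolymatroid g) where
    open IsPolymatroid poly public using (submodular)
    open IsPolymatroid poly using (monotone)

    submodular-∩∪ : ∀ X Y → g (X ∩ Y) + g (X ∪ Y) ≤ g X + g Y
    submodular-∩∪ X Y = subst (_≤ g X + g Y) (+-comm (g (X ∪ Y)) (g (X ∩ Y))) (submodular X Y)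

    mono-≥ : ∀ {U S a} → ⟨ a ⟩ ≤ g U → {True (U ⊆? S)} → ⟨ a ⟩ ≤ g S
    mono-≥ {U} {S} a≤gU {U⊆S} = ≤-trans a≤gU (monotone U S (toWitness U⊆S))

    mono-≤ : ∀ {U S a} → g U ≤ ⟨ a ⟩ → {True (S ⊆? U)} → g S ≤ ⟨ a ⟩
    mono-≤ {U} {S} gU≤a {S⊆U} = ≤-trans (monotone S U (toWitness S⊆U)) gU≤a

  module _ {n′ n} {φ : Subset n′ → Subset n} (φ-map : IsLatticeMap φ) where

    pullback-isPolymatroid : ∀ {g} → IsPolymatroid g → IsPolymatroid (g ∘ φ)
    pullback-isPolymatroid {g} poly = record
      { empty      = trans (cong g (⊥-preserving φ-map)) empty
      ; monotone   = λ X Y X⊆Y → monotone (φ X) (φ Y) (⊆-preserving φ-map X⊆Y)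
      ; submodular = λ X Y → subst₂ (λ U V → g U + g V ≤ g (φ X) + g (φ Y))
                       (sym (∪-preserving φ-map X Y)) (sym (∩-preserving φ-map X Y))
                       (submodular (φ X) (φ Y))
      }
      where open IsPolymatroid poly

    cond-pullback : ∀ g X Z → cond (g ∘ φ) X Z ≡ cond g (φ X) (φ Z)
    cond-pullback g X Z = cong (λ U → g U -ᵣ g (φ Z)) (∪-preserving φ-map X Z)

    mutualInfo-pullback : ∀ g X Y Z → mutualInfo (g ∘ φ) X Y Z ≡ mutualInfo g (φ X) (φ Y) (φ Z)
    mutualInfo-pullback g X Y Z
      rewrite ∪-preserving φ-map X (Y ∪ Z) | ∪-preserving φ-map Y Z | ∪-preserving φ-map X Z = refl

  ⊕-liftE : ∀ {n′ n m′ m} (φ : Subset n′ → Subset n) {χ : Subset m′ → Subset m} →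
            χ S.⊥ ≡ S.⊥ → ∀ X → (φ ⊕ χ) (liftE m′ X) ≡ liftE m (φ X)
  ⊕-liftE φ {χ} χ⊥≡⊥ X =
    trans (cong₂ (λ U V → φ U ++ χ V) (take-++ X S.⊥) (drop-++ X S.⊥)) (cong (φ X ++_) χ⊥≡⊥)

  ⊕-Zset : ∀ {n′ n m′ m} {φ : Subset n′ → Subset n} {χ : Subset m′ → Subset m} →
           φ S.⊥ ≡ S.⊥ → χ S.⊤ ≡ S.⊤ → (φ ⊕ χ) (Zset n′ m′) ≡ Zset n m
  ⊕-Zset {n′} {m′ = m′} {φ = φ} {χ} φ⊥≡⊥ χ⊤≡⊤ = trans
    (cong₂ (λ U V → φ U ++ χ V) (take-++ (S.⊥ {n′}) (S.⊤ {m′})) (drop-++ (S.⊥ {n′}) (S.⊤ {m′})))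
    (cong₂ _++_ φ⊥≡⊥ χ⊤≡⊤)

  k-P₁ : ExtKind → ℕ → ∀ {n} → SetFn n → Set
  k-P₁ P zero    f = Data.Unit.⊤
  k-P₁ P (suc k) {n} f =
    ∀ X Y → Σ (SetFn (n ℕ.+ 1)) λ g → IsExtension f g × P {n} {1} g X Y × k-P₁ P k g

  PullbackStable : ExtKind → Set
  PullbackStable P = ∀ m {n′ n} {φ : Subset n′ → Subset n} {g : SetFn (n ℕ.+ m)} {X Y} →
    IsLatticeMap φ → P g (φ X) (φ Y) → P (g ∘ (φ ⊕ diagonal m)) X Y

  module _ {n′ n m : ℕ} {φ : Subset n′ → Subset n} (φ-map : IsLatticeMap φ) where
    private
      ψ : Subset (n′ ℕ.+ 1) → Subset (n ℕ.+ m)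
      ψ = φ ⊕ diagonal m

      ψ-map : IsLatticeMap ψ
      ψ-map = ⊕-isLatticeMap φ-map (diagonal-isLatticeMap m)

      ψ-Zset : ψ (Zset n′ 1) ≡ Zset n m
      ψ-Zset = ⊕-Zset {n′} {φ = φ} {χ = diagonal m} (⊥-preserving φ-map) refl

      ψ-liftE : ∀ X → ψ (liftE 1 X) ≡ liftE m (φ X)
      ψ-liftE = ⊕-liftE φ {diagonal m} refl

      cond-ψ : ∀ g {A B A′ B′} → ψ A ≡ A′ → ψ B ≡ B′ → cond (g ∘ ψ) A B ≡ cond g A′ B′
      cond-ψ g {A} {B} A≡ B≡ = trans (cond-pullback ψ-map g A B) (cong₂ (cond g) A≡ B≡)

    extension-pullback : ∀ {f g} → IsExtension {n} {m} f g →
                         IsExtension {n′} {1} (f ∘ φ) (g ∘ (φ ⊕ diagonal m))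
    extension-pullback {g = g} (poly , restricts) =
      pullback-isPolymatroid ψ-map poly , λ X → trans (cong g (ψ-liftE X)) (restricts (φ X))

    CI-pullback : ∀ {g X Y} → IsCIExt {n} {m} g (φ X) (φ Y) → IsCIExt (g ∘ (φ ⊕ diagonal m)) X Y
    CI-pullback {g} {X} {Y} (X-closure , Y-closure , independent) =
        trans (cond-ψ g ψ-Zset (ψ-liftE X)) X-closure
      , trans (cond-ψ g ψ-Zset (ψ-liftE Y)) Y-closure
      , (begin
          mutualInfo (g ∘ ψ) (liftE 1 X) (liftE 1 Y) (Zset n′ 1)
            ≡⟨ mutualInfo-pullback ψ-map g (liftE 1 X) (liftE 1 Y) (Zset n′ 1) ⟩
          mutualInfo g (ψ (liftE 1 X)) (ψ (liftE 1 Y)) (ψ (Zset n′ 1))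
            ≡⟨ cong₂ (λ U V → mutualInfo g U V (ψ (Zset n′ 1))) (ψ-liftE X) (ψ-liftE Y) ⟩
          mutualInfo g (liftE m (φ X)) (liftE m (φ Y)) (ψ (Zset n′ 1))
            ≡⟨ cong (mutualInfo g (liftE m (φ X)) (liftE m (φ Y))) ψ-Zset ⟩
          mutualInfo g (liftE m (φ X)) (liftE m (φ Y)) (Zset n m)
            ≡⟨ independent ⟩
          0ℝ ∎)
      where open ≡-Reasoning

    AK-pullback : ∀ {g X Y} → IsAKExt {n} {m} g (φ X) (φ Y) → IsAKExt (g ∘ (φ ⊕ diagonal m)) X Y
    AK-pullback {g} {X} {Y} (closure , exchange) =
        trans (cond-ψ g ψ-Zset (ψ-liftE X)) closure
      , λ X′ X′⊆X → trans (cond-ψ g (ψ-liftE X′) ψ-Zset)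
                      (trans (exchange (φ X′) (⊆-preserving φ-map X′⊆X))
                             (sym (cond-ψ g (ψ-liftE X′) (ψ-liftE Y))))

  CI-pullbackStable : PullbackStable IsCIExt
  CI-pullbackStable m {g = g} {X} {Y} φ-map = CI-pullback φ-map {g} {X} {Y}

  AK-pullbackStable : PullbackStable IsAKExt
  AK-pullbackStable m {g = g} {X} {Y} φ-map = AK-pullback φ-map {g} {X} {Y}

  k-P⇒k-P₁ : ∀ {P : ExtKind} → PullbackStable P →
             ∀ k {n′ n} {f : SetFn n} {φ : Subset n′ → Subset n} →
             IsLatticeMap φ → k-P P k f → k-P₁ P k (f ∘ φ)
  k-P⇒k-P₁ stable zero    φ-map _      = tt
  k-P⇒k-P₁ stable (suc k) {φ = φ} φ-map k-P-f X Y with k-P-f (φ X) (φ Y)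
  ... | m , g , extension , p , k-P-g =
    g ∘ (φ ⊕ diagonal m) ,
    extension-pullback φ-map extension ,
    stable m φ-map p ,
    k-P⇒k-P₁ stable k (⊕-isLatticeMap φ-map (diagonal-isLatticeMap m)) k-P-g

  dual-fromℕ : ∀ {n} (ρ : Subset n → ℕ) X {v} →
               ∣ X ∣ ℕ.+ ρ (∁ X) ≡ ρ S.⊤ ℕ.+ v → dual (λ U → fromℕ (ρ U)) X ≡ ⟨ v ⟩
  dual-fromℕ ρ X {v} ∣X∣+ρ∁X≡ρ⊤+v
    rewrite fromℕ≡⟨⟩ ∣ X ∣ | fromℕ≡⟨⟩ (ρ S.⊤) | fromℕ≡⟨⟩ (ρ (∁ X)) =
    x+z≡y+v⇒x-y+z≡v (⟨⟩-+-≡ ∣ X ∣ (ρ (∁ X)) (ρ S.⊤) v ∣X∣+ρ∁X≡ρ⊤+v)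

  extension-+-≡ : ∀ {n m} {f : SetFn n} {g : SetFn (n ℕ.+ m)} → IsExtension f g →
                  ∀ {a b c d} → f a + f b ≡ f c + f d →
                  g (liftE m a) + g (liftE m b) ≡ g (liftE m c) + g (liftE m d)
  extension-+-≡ (_ , restricts) {a} {b} {c} {d} fa+fb≡fc+fd =
    trans (cong₂ _+_ (restricts a) (restricts b))
          (trans fa+fb≡fc+fd (sym (cong₂ _+_ (restricts c) (restricts d))))

  module _ {n m} (g : SetFn (n ℕ.+ m)) (X Y : Subset n) where
    private
      Z : Subset (n ℕ.+ m)
      Z = Zset n m

      ⇑_ : Subset n → Subset (n ℕ.+ m)
      ⇑_ = liftE m

    CI-closureˡ : IsCIExt g X Y → g (Z ∪ ⇑ X) ≡ g (⇑ X)
    CI-closureˡ (X-closure , _ , _) = x-y≡0⇒x≡y X-closure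

    CI-closureʳ : IsCIExt g X Y → g (Z ∪ ⇑ Y) ≡ g (⇑ Y)
    CI-closureʳ (_ , Y-closure , _) = x-y≡0⇒x≡y Y-closure

    CI-independence : IsCIExt g X Y → g (⇑ X ∪ Z) + g (⇑ Y ∪ Z) ≡ g Z + g (⇑ X ∪ ⇑ Y ∪ Z)
    CI-independence (_ , _ , independent) =
      trans (x+y-z-w≡0⇒x+y≡z+w independent) (+-comm (g (⇑ X ∪ ⇑ Y ∪ Z)) (g Z))

    -- Subtracting the AK identity for X from the one for X′ eliminates g(Z) and g(Y).
    AK-exchange : IsAKExt g X Y → ∀ X′ → X′ ⊆ X →
                  g (⇑ X′ ∪ Z) + g (⇑ X ∪ ⇑ Y) ≡ g (⇑ X′ ∪ ⇑ Y) + g (⇑ X)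
    AK-exchange (closure , exchange) X′ X′⊆X = +-exchange
      (x-y≡z-w⇒x+w≡z+y (exchange X′ X′⊆X))
      (trans (cong (_+ g (⇑ Y)) (sym X-closure)) (x-y≡z-w⇒x+w≡z+y (exchange X id)))
      where
      X-closure : g (⇑ X ∪ Z) ≡ g (⇑ X)
      X-closure = trans (cong g (∪-comm (⇑ X) Z)) (x-y≡0⇒x≡y closure)

module _ {k n} (M : SparsePaving k n) where
  open SparsePaving M

  rank-CH : ∀ {X} → isCH X ≡ true → rank M X ≡ k ℕ.∸ 1
  rank-CH X∈CH rewrite X∈CH = refl

  rank-nonCH : ∀ {X} → isCH X ≡ false → rank M X ≡ ∣ X ∣ ℕ.⊓ k
  rank-nonCH X∉CH rewrite X∉CH = refl

  ∣X∣≢k⇒nonCH : ∀ X → ∣ X ∣ ≢ k → isCH X ≡ false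
  ∣X∣≢k⇒nonCH X ∣X∣≢k with isCH X in X∈?CH
  ... | true  = contradiction (CH-size X X∈?CH) ∣X∣≢k
  ... | false = refl

  rank-∣X∣≢k : ∀ X → ∣ X ∣ ≢ k → rank M X ≡ ∣ X ∣ ℕ.⊓ k
  rank-∣X∣≢k X ∣X∣≢k = rank-nonCH (∣X∣≢k⇒nonCH X ∣X∣≢k)

2₃ : F3
2₃ = Fin.suc (Fin.suc Fin.zero)

A₀ A₁ A₂ B₀ B₁ B₂ : Subset 9
A₀ = A 0₃
A₁ = A 1₃
A₂ = A 2₃
B₀ = B 0₃
B₁ = B 1₃
B₂ = B 2₃

module TTTMatroid (M : SparsePaving 5 9) (ttt : IsTTT M) where
  open SparsePaving M

  A∪B-isCH : ∀ i j → i ≢ 0₃ ⊎ j ≢ 0₃ → isCH (A i ∪ B j) ≡ true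
  A∪B-isCH i j (inj₁ i≢0) = proj₁ ttt i j (λ (i≡0 , _) → i≢0 i≡0)
  A∪B-isCH i j (inj₂ j≢0) = proj₁ ttt i j (λ (_ , j≡0) → j≢0 j≡0)

  A∪B-rank : ∀ i j → i ≢ 0₃ ⊎ j ≢ 0₃ → rank M (A i ∪ B j) ≡ 4
  A∪B-rank i j nonzero = rank-CH M (A∪B-isCH i j nonzero)

  -- In the second kind, A₀ ∪ B₀ meets a circuit-hyperplane in four points.
  A₀∪B₀-nonCH : isCH (A₀ ∪ B₀) ≡ false
  A₀∪B₀-nonCH with proj₂ ttt
  ... | inj₁ (_ , A₀∪B₀∉CH) = A₀∪B₀∉CH
  ... | inj₂ H∈CH with isCH (A₀ ∪ B₀) in A₀∪B₀∈?CH
  ...   | false = refl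
  ...   | true  = contradiction (CH-meet _ _ A₀∪B₀∈?CH H∈CH (λ ())) λ { (ℕ.s≤s (ℕ.s≤s (ℕ.s≤s ()))) }

-- The common information property

module CommonInformation (R : RealNumbers) (M : SparsePaving 5 9) (ttt : IsTTT M)
  (h : Poly.SetFn R 10) (extension : Poly.IsExtension R (rankℝ R M) h)
  (ci : Poly.IsCIExt R h A₁ A₂) where

  open RealNumbers R
  open Poly R
  open RealBounds R
  open Polymatroids R
  open PolymatroidBounds (proj₁ extension)
  open TTTMatroid M ttt

  ⟦_⟧ : Subset 9 → Subset 10
  ⟦_⟧ = liftE 1

  Z : Subset 10
  Z = Zset 9 1

  p₀₀ : Subset 9
  p₀₀ = ⁅ pt 0₃ 0₃ ⁆

  r-value : ∀ X {r} → rank M X ≡ r → h ⟦ X ⟧ ≡ ⟨ r ⟩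
  r-value X rank≡r = trans (proj₂ extension X) (trans (fromℕ≡⟨⟩ (rank M X)) (cong ⟨_⟩ rank≡r))

  r-via-size : ∀ X → {False (∣ X ∣ ℕ.≟ 5)} → h ⟦ X ⟧ ≡ ⟨ ∣ X ∣ ℕ.⊓ 5 ⟩
  r-via-size X {∣X∣≢5} = r-value X (rank-∣X∣≢k M X (toWitnessFalse ∣X∣≢5))

  r-circuit : ∀ i j → i ≢ 0₃ ⊎ j ≢ 0₃ → h ⟦ A i ∪ B j ⟧ ≡ ⟨ 4 ⟩
  r-circuit i j nonzero = r-value (A i ∪ B j) (A∪B-rank i j nonzero)

  A₁Z≡3 : h (⟦ A₁ ⟧ ∪ Z) ≡ ⟨ 3 ⟩
  A₁Z≡3 = trans (CI-closureˡ h A₁ A₂ ci) (r-via-size A₁)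

  A₂Z≡3 : h (⟦ A₂ ⟧ ∪ Z) ≡ ⟨ 3 ⟩
  A₂Z≡3 = trans (CI-closureʳ h A₁ A₂ ci) (r-via-size A₂)

  A₁A₂Z≤5 : h (⟦ A₁ ∪ A₂ ⟧ ∪ Z) ≤ ⟨ 5 ⟩
  A₁A₂Z≤5 = upper-bound 5 (submodular ⟦ A₁ ∪ A₂ ⟧ (⟦ A₁ ⟧ ∪ Z))
    (≥-reflexive (r-via-size A₁)) (≤-reflexive (r-via-size (A₁ ∪ A₂))) (≤-reflexive A₁Z≡3) refl

  Z≥1 : ⟨ 1 ⟩ ≤ h Z
  Z≥1 = lower-bound 1 (≤-reflexive (CI-independence h A₁ A₂ ci))
    (≥-reflexive A₁Z≡3) (≥-reflexive A₂Z≡3) A₁A₂Z≤5 refl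

  B₀Z≤3 : h (⟦ B₀ ⟧ ∪ Z) ≤ ⟨ 3 ⟩
  B₀Z≤3 = upper-bound 3 (submodular-∩∪ (⟦ A₁ ∪ B₀ ⟧ ∪ Z) (⟦ A₂ ∪ B₀ ⟧ ∪ Z))
    (mono-≥ (≥-reflexive (r-via-size (A₁ ∪ A₂ ∪ B₀)))) A₁B₀Z≤4 A₂B₀Z≤4 refl
    where
    A₁B₀Z≤4 : h (⟦ A₁ ∪ B₀ ⟧ ∪ Z) ≤ ⟨ 4 ⟩
    A₁B₀Z≤4 = upper-bound 4 (submodular ⟦ A₁ ∪ B₀ ⟧ (⟦ A₁ ⟧ ∪ Z))
      (≥-reflexive (r-via-size A₁)) (≤-reflexive (r-circuit 1₃ 0₃ (inj₁ λ ())))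
      (≤-reflexive A₁Z≡3) refl
    A₂B₀Z≤4 : h (⟦ A₂ ∪ B₀ ⟧ ∪ Z) ≤ ⟨ 4 ⟩
    A₂B₀Z≤4 = upper-bound 4 (submodular ⟦ A₂ ∪ B₀ ⟧ (⟦ A₂ ⟧ ∪ Z))
      (≥-reflexive (r-via-size A₂)) (≤-reflexive (r-circuit 2₃ 0₃ (inj₁ λ ())))
      (≤-reflexive A₂Z≡3) refl

  B₁Z≤3 : h (⟦ B₁ ⟧ ∪ Z) ≤ ⟨ 3 ⟩
  B₁Z≤3 = upper-bound 3 (submodular-∩∪ (⟦ A₁ ∪ B₁ ⟧ ∪ Z) (⟦ A₂ ∪ B₁ ⟧ ∪ Z))
    (mono-≥ (≥-reflexive (r-via-size (A₁ ∪ A₂ ∪ B₁)))) A₁B₁Z≤4 A₂B₁Z≤4 refl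
    where
    A₁B₁Z≤4 : h (⟦ A₁ ∪ B₁ ⟧ ∪ Z) ≤ ⟨ 4 ⟩
    A₁B₁Z≤4 = upper-bound 4 (submodular ⟦ A₁ ∪ B₁ ⟧ (⟦ A₁ ⟧ ∪ Z))
      (≥-reflexive (r-via-size A₁)) (≤-reflexive (r-circuit 1₃ 1₃ (inj₁ λ ())))
      (≤-reflexive A₁Z≡3) refl
    A₂B₁Z≤4 : h (⟦ A₂ ∪ B₁ ⟧ ∪ Z) ≤ ⟨ 4 ⟩
    A₂B₁Z≤4 = upper-bound 4 (submodular ⟦ A₂ ∪ B₁ ⟧ (⟦ A₂ ⟧ ∪ Z))
      (≥-reflexive (r-via-size A₂)) (≤-reflexive (r-circuit 2₃ 1₃ (inj₁ λ ())))
      (≤-reflexive A₂Z≡3) refl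

  B₂Z≤3 : h (⟦ B₂ ⟧ ∪ Z) ≤ ⟨ 3 ⟩
  B₂Z≤3 = upper-bound 3 (submodular-∩∪ (⟦ A₁ ∪ B₂ ⟧ ∪ Z) (⟦ A₂ ∪ B₂ ⟧ ∪ Z))
    (mono-≥ (≥-reflexive (r-via-size (A₁ ∪ A₂ ∪ B₂)))) A₁B₂Z≤4 A₂B₂Z≤4 refl
    where
    A₁B₂Z≤4 : h (⟦ A₁ ∪ B₂ ⟧ ∪ Z) ≤ ⟨ 4 ⟩
    A₁B₂Z≤4 = upper-bound 4 (submodular ⟦ A₁ ∪ B₂ ⟧ (⟦ A₁ ⟧ ∪ Z))
      (≥-reflexive (r-via-size A₁)) (≤-reflexive (r-circuit 1₃ 2₃ (inj₁ λ ())))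
      (≤-reflexive A₁Z≡3) refl
    A₂B₂Z≤4 : h (⟦ A₂ ∪ B₂ ⟧ ∪ Z) ≤ ⟨ 4 ⟩
    A₂B₂Z≤4 = upper-bound 4 (submodular ⟦ A₂ ∪ B₂ ⟧ (⟦ A₂ ⟧ ∪ Z))
      (≥-reflexive (r-via-size A₂)) (≤-reflexive (r-circuit 2₃ 2₃ (inj₁ λ ())))
      (≤-reflexive A₂Z≡3) refl

  A₀Z≤3 : h (⟦ A₀ ⟧ ∪ Z) ≤ ⟨ 3 ⟩
  A₀Z≤3 = upper-bound 3 (submodular-∩∪ (⟦ A₀ ∪ B₁ ⟧ ∪ Z) (⟦ A₀ ∪ B₂ ⟧ ∪ Z))
    (mono-≥ (≥-reflexive (r-via-size (A₀ ∪ B₁ ∪ B₂)))) A₀B₁Z≤4 A₀B₂Z≤4 refl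
    where
    A₀B₁Z≤4 : h (⟦ A₀ ∪ B₁ ⟧ ∪ Z) ≤ ⟨ 4 ⟩
    A₀B₁Z≤4 = upper-bound 4 (submodular ⟦ A₀ ∪ B₁ ⟧ (⟦ B₁ ⟧ ∪ Z))
      (≥-reflexive (r-via-size B₁)) (≤-reflexive (r-circuit 0₃ 1₃ (inj₂ λ ()))) B₁Z≤3 refl
    A₀B₂Z≤4 : h (⟦ A₀ ∪ B₂ ⟧ ∪ Z) ≤ ⟨ 4 ⟩
    A₀B₂Z≤4 = upper-bound 4 (submodular ⟦ A₀ ∪ B₂ ⟧ (⟦ B₂ ⟧ ∪ Z))
      (≥-reflexive (r-via-size B₂)) (≤-reflexive (r-circuit 0₃ 2₃ (inj₂ λ ()))) B₂Z≤3 refl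

  p₀₀Z≤1 : h (⟦ p₀₀ ⟧ ∪ Z) ≤ ⟨ 1 ⟩
  p₀₀Z≤1 = upper-bound 1 (submodular-∩∪ (⟦ A₀ ⟧ ∪ Z) (⟦ B₀ ⟧ ∪ Z))
    (mono-≥ (≥-reflexive (r-value (A₀ ∪ B₀) (rank-nonCH M (A₀∪B₀-nonCH))))) A₀Z≤3 B₀Z≤3 refl

  contradiction-CI : ⊥
  contradiction-CI = infeasible 3
    (mono-≥ (≥-reflexive (r-via-size (A₁ ∪ p₀₀))))
    (upper-bound 3 (submodular (⟦ A₁ ⟧ ∪ Z) (⟦ p₀₀ ⟧ ∪ Z)) Z≥1 (≤-reflexive A₁Z≡3) p₀₀Z≤1 refl)

module _ (R : RealNumbers) (M : SparsePaving 5 9) (ttt : IsTTT M) where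
  open Poly R
  open Polymatroids R

  TTT-¬CIProperty : ¬ CIProperty (rankℝ R M)
  TTT-¬CIProperty ci
    with k-P⇒k-P₁ {IsCIExt} CI-pullbackStable 1 {f = rankℝ R M} id-isLatticeMap (ci 1) A₁ A₂
  ... | h , extension , ci-extension , _ =
    CommonInformation.contradiction-CI R M ttt h extension ci-extension

-- The Ahlswede–Körner property of the dual

X₁ Y₁ X₂ Y₂ X₃ : Subset 9
X₁ = (B₀ ∪ B₁) ─ A₂
Y₁ = B₂ ─ A₂
X₂ = (B₀ ∪ B₁) ─ A₁
Y₂ = B₂ ─ A₁
X₃ = (B₀ ∪ B₁) ─ A₀

module AhlswedeKorner (R : RealNumbers) (M : SparsePaving 5 9) (ttt : IsTTT M)
  (h₁ : Poly.SetFn R 10) (extension₁ : Poly.IsExtension R (Poly.dual R (rankℝ R M)) h₁)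
  (ak₁ : Poly.IsAKExt R h₁ X₁ Y₁)
  (h₂ : Poly.SetFn R 11) (extension₂ : Poly.IsExtension R h₁ h₂)
  (ak₂ : Poly.IsAKExt R h₂ (Poly.liftE R 1 X₂) (Poly.liftE R 1 Y₂))
  (h : Poly.SetFn R 12) (extension₃ : Poly.IsExtension R h₂ h)
  (ak₃ : Poly.IsAKExt R h (Poly.liftE R 1 (Poly.liftE R 1 X₃))
                          (Poly.liftE R 1 (Poly.Zset R 9 1) ∪ Poly.Zset R 10 1)) where

  open RealNumbers R
  open Poly R
  open RealBounds R
  open Polymatroids R
  open PolymatroidBounds (proj₁ extension₃)
  open TTTMatroid M ttt

  ⟦_⟧ : Subset 9 → Subset 12
  ⟦ X ⟧ = liftE 1 (liftE 1 (liftE 1 X))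

  Z₁ Z₂ Z₃ : Subset 12
  Z₁ = liftE 1 (liftE 1 (Zset 9 1))
  Z₂ = liftE 1 (Zset 10 1)
  Z₃ = Zset 11 1

  p₀₀ : Subset 9
  p₀₀ = ⁅ pt 0₃ 0₃ ⁆

  -- The guard excludes truncation in ∣ X ∣ + r ∸ 5.
  f*-value : ∀ X {r} → rank M (∁ X) ≡ r → {T (5 ℕ.≤ᵇ ∣ X ∣ ℕ.+ r)} →
             h ⟦ X ⟧ ≡ ⟨ ∣ X ∣ ℕ.+ r ℕ.∸ 5 ⟩
  f*-value X {r} rank≡r {5≤∣X∣+r} = begin
    h ⟦ X ⟧                    ≡⟨ proj₂ extension₃ (liftE 1 (liftE 1 X)) ⟩
    h₂ (liftE 1 (liftE 1 X))   ≡⟨ proj₂ extension₂ (liftE 1 X) ⟩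
    h₁ (liftE 1 X)             ≡⟨ proj₂ extension₁ X ⟩
    dual (rankℝ R M) X         ≡⟨ dual-fromℕ (rank M) X ∣X∣+rank∁X≡rank⊤+v ⟩
    ⟨ ∣ X ∣ ℕ.+ r ℕ.∸ 5 ⟩      ∎
    where
    open ≡-Reasoning
    ∣X∣+rank∁X≡rank⊤+v : ∣ X ∣ ℕ.+ rank M (∁ X) ≡ rank M S.⊤ ℕ.+ (∣ X ∣ ℕ.+ r ℕ.∸ 5)
    ∣X∣+rank∁X≡rank⊤+v = trans (cong (∣ X ∣ ℕ.+_) rank≡r)
      (trans (sym (m+[n∸m]≡n (≤ᵇ⇒≤ 5 _ 5≤∣X∣+r)))
             (cong (ℕ._+ (∣ X ∣ ℕ.+ r ℕ.∸ 5)) (sym (rank-∣X∣≢k M S.⊤ (λ ())))))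

  f*-via-size : ∀ X → {False (∣ ∁ X ∣ ℕ.≟ 5)} → {T (5 ℕ.≤ᵇ ∣ X ∣ ℕ.+ ∣ ∁ X ∣ ℕ.⊓ 5)} →
                h ⟦ X ⟧ ≡ ⟨ ∣ X ∣ ℕ.+ ∣ ∁ X ∣ ℕ.⊓ 5 ℕ.∸ 5 ⟩
  f*-via-size X {∣∁X∣≢5} {5≤} = f*-value X (rank-∣X∣≢k M (∁ X) (toWitnessFalse ∣∁X∣≢5)) {5≤}

  exchange₁ : ∀ X′ → {True (X′ ⊆? X₁)} →
    h (liftE 1 (liftE 1 (liftE 1 X′ ∪ Zset 9 1))) + h ⟦ X₁ ∪ Y₁ ⟧ ≡
    h (liftE 1 (liftE 1 (liftE 1 X′ ∪ liftE 1 Y₁))) + h ⟦ X₁ ⟧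
  exchange₁ X′ {X′⊆X₁} = extension-+-≡ extension₃ (extension-+-≡ extension₂
    (AK-exchange h₁ X₁ Y₁ ak₁ X′ (toWitness X′⊆X₁)))

  exchange₂ : ∀ (X′ : Subset 9) → {True (liftE 1 X′ ⊆? liftE 1 X₂)} →
    h (liftE 1 (liftE 1 (liftE 1 X′) ∪ Zset 10 1)) + h ⟦ X₂ ∪ Y₂ ⟧ ≡
    h (liftE 1 (liftE 1 (liftE 1 X′) ∪ liftE 1 (liftE 1 Y₂))) + h ⟦ X₂ ⟧
  exchange₂ X′ {X′⊆X₂} = extension-+-≡ extension₃
    (AK-exchange h₂ (liftE 1 X₂) (liftE 1 Y₂) ak₂ (liftE 1 X′) (toWitness X′⊆X₂))

  exchange₃ : ∀ (X′ : Subset 9) → {True (liftE 1 (liftE 1 X′) ⊆? liftE 1 (liftE 1 X₃))} →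
    h (⟦ X′ ⟧ ∪ Z₃) + h (⟦ X₃ ⟧ ∪ Z₁ ∪ Z₂) ≡ h (⟦ X′ ⟧ ∪ Z₁ ∪ Z₂) + h ⟦ X₃ ⟧
  exchange₃ X′ {X′⊆X₃} = AK-exchange h (liftE 1 (liftE 1 X₃)) (liftE 1 (Zset 9 1) ∪ Zset 10 1) ak₃
    (liftE 1 (liftE 1 X′)) (toWitness X′⊆X₃)

  X₁≡3 : h ⟦ X₁ ⟧ ≡ ⟨ 3 ⟩
  X₁≡3 = f*-value X₁ (A∪B-rank 2₃ 2₃ (inj₁ λ ()))

  X₁Y₁≡4 : h ⟦ X₁ ∪ Y₁ ⟧ ≡ ⟨ 4 ⟩
  X₁Y₁≡4 = f*-via-size (X₁ ∪ Y₁)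

  [B₀B₂─A₂]≡3 : h ⟦ (B₀ ∪ B₂) ─ A₂ ⟧ ≡ ⟨ 3 ⟩
  [B₀B₂─A₂]≡3 = f*-value ((B₀ ∪ B₂) ─ A₂) (A∪B-rank 2₃ 1₃ (inj₁ λ ()))

  [B₁B₂─A₂]≡3 : h ⟦ (B₁ ∪ B₂) ─ A₂ ⟧ ≡ ⟨ 3 ⟩
  [B₁B₂─A₂]≡3 = f*-value ((B₁ ∪ B₂) ─ A₂) (A∪B-rank 2₃ 0₃ (inj₁ λ ()))

  X₂≡3 : h ⟦ X₂ ⟧ ≡ ⟨ 3 ⟩
  X₂≡3 = f*-value X₂ (A∪B-rank 1₃ 2₃ (inj₁ λ ()))

  X₂Y₂≡4 : h ⟦ X₂ ∪ Y₂ ⟧ ≡ ⟨ 4 ⟩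
  X₂Y₂≡4 = f*-via-size (X₂ ∪ Y₂)

  [B₀B₂─A₁]≡3 : h ⟦ (B₀ ∪ B₂) ─ A₁ ⟧ ≡ ⟨ 3 ⟩
  [B₀B₂─A₁]≡3 = f*-value ((B₀ ∪ B₂) ─ A₁) (A∪B-rank 1₃ 1₃ (inj₁ λ ()))

  [B₁B₂─A₁]≡3 : h ⟦ (B₁ ∪ B₂) ─ A₁ ⟧ ≡ ⟨ 3 ⟩
  [B₁B₂─A₁]≡3 = f*-value ((B₁ ∪ B₂) ─ A₁) (A∪B-rank 1₃ 0₃ (inj₁ λ ()))

  X₃≡3 : h ⟦ X₃ ⟧ ≡ ⟨ 3 ⟩
  X₃≡3 = f*-value X₃ (A∪B-rank 0₃ 2₃ (inj₂ λ ()))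

  Z₁≥1 : ⟨ 1 ⟩ ≤ h Z₁
  Z₁≥1 = lower-bound 1 (≥-reflexive (exchange₁ S.⊥))
    (≥-reflexive (f*-via-size Y₁)) (≥-reflexive X₁≡3) (≤-reflexive X₁Y₁≡4) refl

  X₁Z₁≤3 : h (⟦ X₁ ⟧ ∪ Z₁) ≤ ⟨ 3 ⟩
  X₁Z₁≤3 = upper-bound 3 (≤-reflexive (exchange₁ X₁))
    (≥-reflexive X₁Y₁≡4) (≤-reflexive X₁Y₁≡4) (≤-reflexive X₁≡3) refl

  [B₀─A₂]Z₁≤2 : h (⟦ B₀ ─ A₂ ⟧ ∪ Z₁) ≤ ⟨ 2 ⟩
  [B₀─A₂]Z₁≤2 = upper-bound 2 (≤-reflexive (exchange₁ (B₀ ─ A₂)))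
    (≥-reflexive X₁Y₁≡4)
    (≤-reflexive [B₀B₂─A₂]≡3) (≤-reflexive X₁≡3) refl

  [B₁─A₂]Z₁≤2 : h (⟦ B₁ ─ A₂ ⟧ ∪ Z₁) ≤ ⟨ 2 ⟩
  [B₁─A₂]Z₁≤2 = upper-bound 2 (≤-reflexive (exchange₁ (B₁ ─ A₂)))
    (≥-reflexive X₁Y₁≡4)
    (≤-reflexive [B₁B₂─A₂]≡3) (≤-reflexive X₁≡3) refl

  [B₂─A₂]Z₁≤2 : h (⟦ B₂ ─ A₂ ⟧ ∪ Z₁) ≤ ⟨ 2 ⟩
  [B₂─A₂]Z₁≤2 = upper-bound 2
    (submodular-∩∪ (⟦ (B₀ ∪ B₂) ─ A₂ ⟧ ∪ Z₁) (⟦ (B₁ ∪ B₂) ─ A₂ ⟧ ∪ Z₁))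
    (mono-≥ (≥-reflexive X₁Y₁≡4)) [B₀B₂─A₂]Z₁≤3 [B₁B₂─A₂]Z₁≤3 refl
    where
    [B₀B₂─A₂]Z₁≤3 : h (⟦ (B₀ ∪ B₂) ─ A₂ ⟧ ∪ Z₁) ≤ ⟨ 3 ⟩
    [B₀B₂─A₂]Z₁≤3 = upper-bound 3 (submodular ⟦ (B₀ ∪ B₂) ─ A₂ ⟧ (⟦ B₀ ─ A₂ ⟧ ∪ Z₁))
      (≥-reflexive (f*-via-size (B₀ ─ A₂)))
      (≤-reflexive [B₀B₂─A₂]≡3) [B₀─A₂]Z₁≤2 refl
    [B₁B₂─A₂]Z₁≤3 : h (⟦ (B₁ ∪ B₂) ─ A₂ ⟧ ∪ Z₁) ≤ ⟨ 3 ⟩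
    [B₁B₂─A₂]Z₁≤3 = upper-bound 3 (submodular ⟦ (B₁ ∪ B₂) ─ A₂ ⟧ (⟦ B₁ ─ A₂ ⟧ ∪ Z₁))
      (≥-reflexive (f*-via-size (B₁ ─ A₂)))
      (≤-reflexive [B₁B₂─A₂]≡3) [B₁─A₂]Z₁≤2 refl

  B₀Z₁≤3 : h (⟦ B₀ ⟧ ∪ Z₁) ≤ ⟨ 3 ⟩
  B₀Z₁≤3 = upper-bound 3 (submodular ⟦ B₀ ⟧ (⟦ B₀ ─ A₂ ⟧ ∪ Z₁))
    (≥-reflexive (f*-via-size (B₀ ─ A₂))) (≤-reflexive (f*-via-size B₀)) [B₀─A₂]Z₁≤2 refl

  B₁Z₁≤3 : h (⟦ B₁ ⟧ ∪ Z₁) ≤ ⟨ 3 ⟩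
  B₁Z₁≤3 = upper-bound 3 (submodular ⟦ B₁ ⟧ (⟦ B₁ ─ A₂ ⟧ ∪ Z₁))
    (≥-reflexive (f*-via-size (B₁ ─ A₂))) (≤-reflexive (f*-via-size B₁)) [B₁─A₂]Z₁≤2 refl

  B₂Z₁≤3 : h (⟦ B₂ ⟧ ∪ Z₁) ≤ ⟨ 3 ⟩
  B₂Z₁≤3 = upper-bound 3 (submodular ⟦ B₂ ⟧ (⟦ B₂ ─ A₂ ⟧ ∪ Z₁))
    (≥-reflexive (f*-via-size (B₂ ─ A₂))) (≤-reflexive (f*-via-size B₂)) [B₂─A₂]Z₁≤2 refl

  p₀₀Z₁≥2 : ⟨ 2 ⟩ ≤ h (⟦ p₀₀ ⟧ ∪ Z₁)
  p₀₀Z₁≥2 = lower-bound 2 (submodular (⟦ p₀₀ ⟧ ∪ Z₁) (⟦ B₁ ─ A₂ ⟧ ∪ Z₁))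
    (mono-≥ (≥-reflexive (f*-via-size (p₀₀ ∪ (B₁ ─ A₂))))) Z₁≥1 [B₁─A₂]Z₁≤2 refl

  [B₀─A₁]Z₁≥3 : ⟨ 3 ⟩ ≤ h (⟦ B₀ ─ A₁ ⟧ ∪ Z₁)
  [B₀─A₁]Z₁≥3 = lower-bound 3 (submodular (⟦ B₀ ─ A₁ ⟧ ∪ Z₁) (⟦ B₀ ─ A₂ ⟧ ∪ Z₁))
    (mono-≥ (≥-reflexive (f*-via-size B₀))) p₀₀Z₁≥2 [B₀─A₂]Z₁≤2 refl

  EZ₁≤4 : h (⟦ S.⊤ ⟧ ∪ Z₁) ≤ ⟨ 4 ⟩
  EZ₁≤4 = upper-bound 4 (submodular ⟦ S.⊤ ⟧ (⟦ X₁ ⟧ ∪ Z₁))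
    (≥-reflexive X₁≡3) (≤-reflexive (f*-via-size S.⊤)) X₁Z₁≤3 refl

  Z₂≥1 : ⟨ 1 ⟩ ≤ h Z₂
  Z₂≥1 = lower-bound 1 (≥-reflexive (exchange₂ S.⊥))
    (≥-reflexive (f*-via-size Y₂)) (≥-reflexive X₂≡3) (≤-reflexive X₂Y₂≡4) refl

  X₂Z₂≤3 : h (⟦ X₂ ⟧ ∪ Z₂) ≤ ⟨ 3 ⟩
  X₂Z₂≤3 = upper-bound 3 (≤-reflexive (exchange₂ X₂))
    (≥-reflexive X₂Y₂≡4) (≤-reflexive X₂Y₂≡4) (≤-reflexive X₂≡3) refl

  [B₀─A₁]Z₂≤2 : h (⟦ B₀ ─ A₁ ⟧ ∪ Z₂) ≤ ⟨ 2 ⟩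
  [B₀─A₁]Z₂≤2 = upper-bound 2 (≤-reflexive (exchange₂ (B₀ ─ A₁)))
    (≥-reflexive X₂Y₂≡4)
    (≤-reflexive [B₀B₂─A₁]≡3) (≤-reflexive X₂≡3) refl

  [B₁─A₁]Z₂≤2 : h (⟦ B₁ ─ A₁ ⟧ ∪ Z₂) ≤ ⟨ 2 ⟩
  [B₁─A₁]Z₂≤2 = upper-bound 2 (≤-reflexive (exchange₂ (B₁ ─ A₁)))
    (≥-reflexive X₂Y₂≡4)
    (≤-reflexive [B₁B₂─A₁]≡3) (≤-reflexive X₂≡3) refl

  [B₂─A₁]Z₂≤2 : h (⟦ B₂ ─ A₁ ⟧ ∪ Z₂) ≤ ⟨ 2 ⟩
  [B₂─A₁]Z₂≤2 = upper-bound 2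
    (submodular-∩∪ (⟦ (B₀ ∪ B₂) ─ A₁ ⟧ ∪ Z₂) (⟦ (B₁ ∪ B₂) ─ A₁ ⟧ ∪ Z₂))
    (mono-≥ (≥-reflexive X₂Y₂≡4)) [B₀B₂─A₁]Z₂≤3 [B₁B₂─A₁]Z₂≤3 refl
    where
    [B₀B₂─A₁]Z₂≤3 : h (⟦ (B₀ ∪ B₂) ─ A₁ ⟧ ∪ Z₂) ≤ ⟨ 3 ⟩
    [B₀B₂─A₁]Z₂≤3 = upper-bound 3 (submodular ⟦ (B₀ ∪ B₂) ─ A₁ ⟧ (⟦ B₀ ─ A₁ ⟧ ∪ Z₂))
      (≥-reflexive (f*-via-size (B₀ ─ A₁)))
      (≤-reflexive [B₀B₂─A₁]≡3) [B₀─A₁]Z₂≤2 refl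
    [B₁B₂─A₁]Z₂≤3 : h (⟦ (B₁ ∪ B₂) ─ A₁ ⟧ ∪ Z₂) ≤ ⟨ 3 ⟩
    [B₁B₂─A₁]Z₂≤3 = upper-bound 3 (submodular ⟦ (B₁ ∪ B₂) ─ A₁ ⟧ (⟦ B₁ ─ A₁ ⟧ ∪ Z₂))
      (≥-reflexive (f*-via-size (B₁ ─ A₁)))
      (≤-reflexive [B₁B₂─A₁]≡3) [B₁─A₁]Z₂≤2 refl

  B₀Z₂≤3 : h (⟦ B₀ ⟧ ∪ Z₂) ≤ ⟨ 3 ⟩
  B₀Z₂≤3 = upper-bound 3 (submodular ⟦ B₀ ⟧ (⟦ B₀ ─ A₁ ⟧ ∪ Z₂))
    (≥-reflexive (f*-via-size (B₀ ─ A₁))) (≤-reflexive (f*-via-size B₀)) [B₀─A₁]Z₂≤2 refl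

  B₁Z₂≤3 : h (⟦ B₁ ⟧ ∪ Z₂) ≤ ⟨ 3 ⟩
  B₁Z₂≤3 = upper-bound 3 (submodular ⟦ B₁ ⟧ (⟦ B₁ ─ A₁ ⟧ ∪ Z₂))
    (≥-reflexive (f*-via-size (B₁ ─ A₁))) (≤-reflexive (f*-via-size B₁)) [B₁─A₁]Z₂≤2 refl

  B₂Z₂≤3 : h (⟦ B₂ ⟧ ∪ Z₂) ≤ ⟨ 3 ⟩
  B₂Z₂≤3 = upper-bound 3 (submodular ⟦ B₂ ⟧ (⟦ B₂ ─ A₁ ⟧ ∪ Z₂))
    (≥-reflexive (f*-via-size (B₂ ─ A₁))) (≤-reflexive (f*-via-size B₂)) [B₂─A₁]Z₂≤2 refl

  Z₁Z₂≥2 : ⟨ 2 ⟩ ≤ h (Z₁ ∪ Z₂)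
  Z₁Z₂≥2 = lower-bound 2 (submodular (Z₁ ∪ Z₂) (⟦ B₀ ─ A₁ ⟧ ∪ Z₂))
    (mono-≥ [B₀─A₁]Z₁≥3) Z₂≥1 [B₀─A₁]Z₂≤2 refl

  B₀Z₁Z₂≤3 : h (⟦ B₀ ⟧ ∪ Z₁ ∪ Z₂) ≤ ⟨ 3 ⟩
  B₀Z₁Z₂≤3 = upper-bound 3 (submodular (⟦ B₀ ⟧ ∪ Z₁) (⟦ B₀ ⟧ ∪ Z₂))
    (≥-reflexive (f*-via-size B₀)) B₀Z₁≤3 B₀Z₂≤3 refl

  B₁Z₁Z₂≤3 : h (⟦ B₁ ⟧ ∪ Z₁ ∪ Z₂) ≤ ⟨ 3 ⟩
  B₁Z₁Z₂≤3 = upper-bound 3 (submodular (⟦ B₁ ⟧ ∪ Z₁) (⟦ B₁ ⟧ ∪ Z₂))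
    (≥-reflexive (f*-via-size B₁)) B₁Z₁≤3 B₁Z₂≤3 refl

  B₂Z₁Z₂≤3 : h (⟦ B₂ ⟧ ∪ Z₁ ∪ Z₂) ≤ ⟨ 3 ⟩
  B₂Z₁Z₂≤3 = upper-bound 3 (submodular (⟦ B₂ ⟧ ∪ Z₁) (⟦ B₂ ⟧ ∪ Z₂))
    (≥-reflexive (f*-via-size B₂)) B₂Z₁≤3 B₂Z₂≤3 refl

  EZ₁Z₂≤4 : h (⟦ S.⊤ ⟧ ∪ Z₁ ∪ Z₂) ≤ ⟨ 4 ⟩
  EZ₁Z₂≤4 = upper-bound 4 (submodular (⟦ S.⊤ ⟧ ∪ Z₁) (⟦ X₂ ⟧ ∪ Z₂))
    (≥-reflexive X₂≡3) EZ₁≤4 X₂Z₂≤3 refl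

  Z₃≥1 : ⟨ 1 ⟩ ≤ h Z₃
  Z₃≥1 = lower-bound 1 (≥-reflexive (exchange₃ S.⊥))
    Z₁Z₂≥2 (≥-reflexive X₃≡3) (mono-≤ EZ₁Z₂≤4) refl

  [B₀─A₀]Z₃≤2 : h (⟦ B₀ ─ A₀ ⟧ ∪ Z₃) ≤ ⟨ 2 ⟩
  [B₀─A₀]Z₃≤2 = difference-elim 2 (≤-reflexive (exchange₃ (B₀ ─ A₀))) (≤-reflexive X₃≡3)
    (difference-bound (submodular (⟦ B₀ ⟧ ∪ Z₁ ∪ Z₂) (⟦ X₃ ⟧ ∪ Z₁ ∪ Z₂))
      (mono-≥ (≥-reflexive (f*-via-size (B₀ ∪ X₃)))) B₀Z₁Z₂≤3) refl

  [B₁─A₀]Z₃≤2 : h (⟦ B₁ ─ A₀ ⟧ ∪ Z₃) ≤ ⟨ 2 ⟩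
  [B₁─A₀]Z₃≤2 = difference-elim 2 (≤-reflexive (exchange₃ (B₁ ─ A₀))) (≤-reflexive X₃≡3)
    (difference-bound (submodular (⟦ B₁ ⟧ ∪ Z₁ ∪ Z₂) (⟦ X₃ ⟧ ∪ Z₁ ∪ Z₂))
      (mono-≥ (≥-reflexive (f*-via-size (B₁ ∪ X₃)))) B₁Z₁Z₂≤3) refl

  Z₁Z₂Z₃≤2 : h (Z₁ ∪ Z₂ ∪ Z₃) ≤ ⟨ 2 ⟩
  Z₁Z₂Z₃≤2 = upper-bound 2 (submodular-∩∪ (⟦ B₀ ⟧ ∪ Z₁ ∪ Z₂ ∪ Z₃) (⟦ B₁ ⟧ ∪ Z₁ ∪ Z₂ ∪ Z₃))
    (mono-≥ (≥-reflexive (f*-via-size (B₀ ∪ B₁)))) B₀Z₁Z₂Z₃≤3 B₁Z₁Z₂Z₃≤3 refl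
    where
    B₀Z₁Z₂Z₃≤3 : h (⟦ B₀ ⟧ ∪ Z₁ ∪ Z₂ ∪ Z₃) ≤ ⟨ 3 ⟩
    B₀Z₁Z₂Z₃≤3 = upper-bound 3 (submodular (⟦ B₀ ⟧ ∪ Z₁ ∪ Z₂) (⟦ B₀ ─ A₀ ⟧ ∪ Z₃))
      (≥-reflexive (f*-via-size (B₀ ─ A₀))) B₀Z₁Z₂≤3 [B₀─A₀]Z₃≤2 refl
    B₁Z₁Z₂Z₃≤3 : h (⟦ B₁ ⟧ ∪ Z₁ ∪ Z₂ ∪ Z₃) ≤ ⟨ 3 ⟩
    B₁Z₁Z₂Z₃≤3 = upper-bound 3 (submodular (⟦ B₁ ⟧ ∪ Z₁ ∪ Z₂) (⟦ B₁ ─ A₀ ⟧ ∪ Z₃))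
      (≥-reflexive (f*-via-size (B₁ ─ A₀))) B₁Z₁Z₂≤3 [B₁─A₀]Z₃≤2 refl

  B₂Z₃≤3 : h (⟦ B₂ ⟧ ∪ Z₃) ≤ ⟨ 3 ⟩
  B₂Z₃≤3 = mono-≤ (upper-bound 3 (submodular (⟦ B₂ ⟧ ∪ Z₁ ∪ Z₂) (Z₁ ∪ Z₂ ∪ Z₃))
    Z₁Z₂≥2 B₂Z₁Z₂≤3 Z₁Z₂Z₃≤2 refl)

  [B₂─A₀]Z₃≤2 : h (⟦ B₂ ─ A₀ ⟧ ∪ Z₃) ≤ ⟨ 2 ⟩
  [B₂─A₀]Z₃≤2 = upper-bound 2 (submodular-∩∪ (⟦ B₂ ⟧ ∪ Z₃) (⟦ (B₀ ∪ B₂) ─ A₀ ⟧ ∪ Z₃))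
    (mono-≥ (≥-reflexive (f*-via-size (B₂ ∪ (B₀ ─ A₀))))) B₂Z₃≤3 [B₀B₂─A₀]Z₃≤3 refl
    where
    [B₀B₂─A₀]Z₃≤3 : h (⟦ (B₀ ∪ B₂) ─ A₀ ⟧ ∪ Z₃) ≤ ⟨ 3 ⟩
    [B₀B₂─A₀]Z₃≤3 = upper-bound 3 (submodular ⟦ (B₀ ∪ B₂) ─ A₀ ⟧ (⟦ B₀ ─ A₀ ⟧ ∪ Z₃))
      (≥-reflexive (f*-via-size (B₀ ─ A₀)))
      (≤-reflexive (f*-value ((B₀ ∪ B₂) ─ A₀) (A∪B-rank 0₃ 1₃ (inj₂ λ ())))) [B₀─A₀]Z₃≤2 refl

  contradiction-AK : ⊥
  contradiction-AK = infeasible 3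
    (mono-≥ (≥-reflexive (f*-value ((B₁ ∪ B₂) ─ A₀) (rank-nonCH M (A₀∪B₀-nonCH)))))
    (upper-bound 3 (submodular (⟦ B₁ ─ A₀ ⟧ ∪ Z₃) (⟦ B₂ ─ A₀ ⟧ ∪ Z₃))
      Z₃≥1 [B₁─A₀]Z₃≤2 [B₂─A₀]Z₃≤2 refl)

module _ (R : RealNumbers) (M : SparsePaving 5 9) (ttt : IsTTT M) where
  open Poly R
  open Polymatroids R

  TTT-dual-¬AKProperty : ¬ AKProperty (dual (rankℝ R M))
  TTT-dual-¬AKProperty ak
    with k-P⇒k-P₁ {IsAKExt} AK-pullbackStable 3 {f = dual (rankℝ R M)} id-isLatticeMap (ak 3) X₁ Y₁
  ... | h₁ , extension₁ , ak₁ , extend₁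
    with extend₁ (liftE 1 X₂) (liftE 1 Y₂)
  ... | h₂ , extension₂ , ak₂ , extend₂
    with extend₂ (liftE 1 (liftE 1 X₃)) (liftE 1 (Zset 9 1) ∪ Zset 10 1)
  ... | h , extension₃ , ak₃ , _ =
    AhlswedeKorner.contradiction-AK R M ttt h₁ extension₁ ak₁ h₂ extension₂ ak₂ h extension₃ ak₃

mainTheorem10 : (R : RealNumbers) → (M : SparsePaving 5 9) → IsTTT M →
    ¬ Poly.CIProperty R (rankℝ R M) × ¬ Poly.AKProperty R (Poly.dual R (rankℝ R M))
mainTheorem10 R M ttt = TTT-¬CIProperty R M ttt , TTT-dual-¬AKProperty R M ttt
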